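{- Let $n, s, t$ be integers with $1\leq s,t\leq n$ and $\gcd(n,s,t)=1$, such that for every integer $a$ with $\gcd(a,n)=1$ we have $\frac{n}{2} < (as \bmod n) + (at \bmod n) < \frac{3n}{2}$. Suppose moreover that either $6<\gcd(n,t)<\frac{n}{10}$, or $\gcd(n,t)=5$. Then at least one of the following holds: $n\leq 78$; $s+t=n$; $s+2t=n$; $2s+t=n$; or $n$ is even and $|s-t|=\frac{n}{2}$.
   Context: For an integer $x$, $x \bmod n$ denotes the least nonnegative residue of $x$ modulo $n$. -}

module Defs where

-- Write g = gcd n t and n = m g. For n > 78 the hypothesis on g forces m ≥ 11, g ≥ 5, and g ≥ 12 when
-- 6 ∣ g, and we exhibit a unit a modulo n with a t ≡ g and a s ≡ r + m j (mod n), where r < m and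
-- 5 (j + 1) ≤ 2 g; then (a s mod n) + (a t mod n) ≤ n / 2, contradicting the hypothesis at a.
-- Inverting t / g modulo m fixes a modulo m (and makes a t ≡ g); inverting s modulo g then lets a s run
-- through every r + m j. Such a is a unit as soon as r + m j is coprime to the part of g coprime to m.
-- If that part has a prime factor q ≥ 5, a suitable j lies below 2 g / q: solve r + m j ≡ 1 modulo the
-- q-free part Y, and if q still divides r + m j, replace j by j + Y. Otherwise only the primes 2 and 3
-- remain and the few cases are checked directly.

module Submission where

open import Defs
open import Data.Nat using (ℕ; _+_; _*_; _≤_; _<_; NonZero; ∣_-_∣)
open import Data.Nat.GCD using (gcd)
open import Data.Integer using (ℤ; +_)
open import Data.Integer.GCD using () renaming (gcd to gcdℤ)
open import Data.Integer.DivMod using (_%ℕ_)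
open import Data.Product using (_×_)
open import Data.Sum using (_⊎_)
open import Relation.Binary.PropositionalEquality using (_≡_)

open import Data.Nat.Base
  using ( zero; suc; z≤n; s≤s; _∸_; _/_; _%_; NonTrivial; >-nonZero; >-nonZero⁻¹; ≢-nonZero; ≢-nonZero⁻¹
        ; n>1⇒nonTrivial; nonTrivial⇒≢1; nonTrivial⇒n>1; nonTrivial⇒nonZero )
open import Data.Nat.Properties
open import Data.Nat.Divisibility
open import Data.Nat.DivMod
open import Data.Nat.GCD using (gcd[m,n]∣m; gcd[m,n]∣n; gcd-greatest; gcd[m,n]≢0; module Bézout)
open import Data.Nat.Coprimality
  using (Coprime; 1-coprimeTo; coprime-divisor; coprime-Bézout; coprime-/gcd; coprime⇒gcd≡1; gcd≡1⇒coprime)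
  renaming (sym to coprime-sym)
open import Data.Nat.Induction using (<-wellFounded)
open import Data.Nat.Primality
  using (Prime; prime?; prime[2]; prime⇒irreducible; prime⇒nonTrivial; euclidsLemma; composite[4]; composite⇒¬prime)
open import Data.Nat.Primality.Factorisation using (factorise)
open import Data.Nat.Tactic.RingSolver using (solve-∀)
open import Data.Integer.Properties using (pos-*)
open import Data.List.Base using (_∷_)
open import Data.Nat.ListAction using (product)
open import Data.List.Relation.Unary.All using (_∷_)
open import Data.Product using (∃-syntax; ∄-syntax; _,_; proj₁)
open import Data.Sum using (inj₁; inj₂)
open import Data.Empty using (⊥-elim)
open import Function using (_∘_)
open import Induction.WellFounded using (Acc; acc)
open import Relation.Nullary using (¬_; Dec; yes; no; contradiction)
open import Relation.Nullary.Decidable using (from-yes; from-no)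
open import Relation.Binary.PropositionalEquality
  using (_≢_; refl; sym; trans; cong; cong₂; subst; module ≡-Reasoning)

private
  variable
    b c d m n p q s t x M N X : ℕ

∣⇒nonZero : .{{NonZero n}} → d ∣ n → NonZero d
∣⇒nonZero {n} {zero} 0∣n = contradiction (0∣⇒≡0 0∣n) (≢-nonZero⁻¹ n)
∣⇒nonZero {d = suc _} _ = _

∣m+n∣n⇒∣m : d ∣ m + n → d ∣ n → d ∣ m
∣m+n∣n⇒∣m {d} {m} {n} d∣m+n = ∣m+n∣m⇒∣n (subst (d ∣_) (+-comm m n) d∣m+n)

≢1⇒1< : .{{NonZero n}} → n ≢ 1 → 1 < n
≢1⇒1< {n} n≢1 = ≤∧≢⇒< (>-nonZero⁻¹ n) (n≢1 ∘ sym)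

m≡r+kn⇒m%n≡r : ∀ {r k} .{{_ : NonZero n}} → m ≡ r + k * n → r < n → m % n ≡ r
m≡r+kn⇒m%n≡r {n} {k = k} refl r<n = trans ([m+kn]%n≡m%n _ k n) (m<n⇒m%n≡m r<n)

coprime-∣ˡ : Coprime m x → d ∣ m → Coprime d x
coprime-∣ˡ m⊥x d∣m (e∣d , e∣x) = m⊥x (∣-trans e∣d d∣m , e∣x)

coprime-∣ʳ : Coprime x m → d ∣ m → Coprime x d
coprime-∣ʳ x⊥m d∣m = coprime-sym (coprime-∣ˡ (coprime-sym x⊥m) d∣m)

coprime-* : Coprime x m → Coprime x n → Coprime x (m * n)
coprime-* x⊥m x⊥n (e∣x , e∣mn) = x⊥n (e∣x , coprime-divisor (coprime-∣ˡ x⊥m e∣x) e∣mn)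

coprime-+-* : ∀ {k} → M ∣ N → Coprime x M → Coprime (x + k * N) M
coprime-+-* {k = k} M∣N x⊥M (e∣x+kN , e∣M) =
  x⊥M (∣m+n∣n⇒∣m e∣x+kN (∣n⇒∣m*n k (∣-trans e∣M M∣N)) , e∣M)

coprime-+-*⁻¹ : ∀ {k} → M ∣ N → Coprime (x + k * N) M → Coprime x M
coprime-+-*⁻¹ {k = k} M∣N x+kN⊥M (e∣x , e∣M) =
  x+kN⊥M (∣m∣n⇒∣m+n e∣x (∣n⇒∣m*n k (∣-trans e∣M M∣N)) , e∣M)

∤⇒coprime : Prime p → ¬ p ∣ x → Coprime x p
∤⇒coprime p-prime p∤x (e∣x , e∣p) with prime⇒irreducible p-prime e∣p
... | inj₁ e≡1 = e≡1
... | inj₂ refl = contradiction e∣x p∤x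

prime∣coprime⇒∤ : Prime p → Coprime m n → p ∣ m → ¬ p ∣ n
prime∣coprime⇒∤ p-prime m⊥n p∣m p∣n = nonTrivial⇒≢1 {{prime⇒nonTrivial p-prime}} (m⊥n (p∣m , p∣n))

prime-factor : .{{NonTrivial n}} → ∃[ p ] Prime p × p ∣ n
prime-factor {n@(suc (suc _))} with factorise n
... | record { factors = p ∷ ps ; isFactorisation = n≡p*ps ; factorsPrime = p-prime ∷ _ } =
  p , p-prime , divides (product ps) (trans n≡p*ps (*-comm p (product ps)))

prime⊥6⇒5≤p : Prime p → Coprime p 6 → 5 ≤ p
prime⊥6⇒5≤p {0} p-prime _ = contradiction (nonTrivial⇒n>1 0 {{prime⇒nonTrivial p-prime}}) λ ()
prime⊥6⇒5≤p {1} p-prime _ = contradiction (nonTrivial⇒n>1 1 {{prime⇒nonTrivial p-prime}}) λ { (s≤s ()) }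
prime⊥6⇒5≤p {2} _ 2⊥6 = contradiction (2⊥6 (∣-refl , divides 3 refl)) λ ()
prime⊥6⇒5≤p {3} _ 3⊥6 = contradiction (3⊥6 (∣-refl , divides 2 refl)) λ ()
prime⊥6⇒5≤p {4} 4-prime _ = contradiction 4-prime (composite⇒¬prime composite[4])
prime⊥6⇒5≤p {suc (suc (suc (suc (suc _))))} _ _ = s≤s (s≤s (s≤s (s≤s (s≤s z≤n))))

divisor-of-6 : d ∣ 6 → d ≡ 1 ⊎ d ≡ 2 ⊎ d ≡ 3 ⊎ d ≡ 6
divisor-of-6 {0} 0∣6 = contradiction (0∣⇒≡0 0∣6) λ ()
divisor-of-6 {1} _ = inj₁ refl
divisor-of-6 {2} _ = inj₂ (inj₁ refl)
divisor-of-6 {3} _ = inj₂ (inj₂ (inj₁ refl))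
divisor-of-6 {4} 4∣6 = contradiction 4∣6 (from-no (4 ∣? 6))
divisor-of-6 {5} 5∣6 = contradiction 5∣6 (from-no (5 ∣? 6))
divisor-of-6 {6} _ = inj₂ (inj₂ (inj₂ refl))
divisor-of-6 {suc (suc (suc (suc (suc (suc (suc _))))))} d∣6 =
  contradiction (∣⇒≤ d∣6) λ { (s≤s (s≤s (s≤s (s≤s (s≤s (s≤s ())))))) }

-- part is the largest divisor of X coprime to c; lift-coprime says that every prime of X / part divides c.

record CoprimePart (c X : ℕ) : Set where
  field
    part         : ℕ
    part∣        : part ∣ X
    part-coprime : Coprime part c
    lift-coprime : ∀ {x} → Coprime x part → Coprime x (gcd X c) → Coprime x X

coprimePart : ∀ c X → .{{NonZero X}} → CoprimePart c X
coprimePart c X = go X (<-wellFounded X)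
  where
  go : ∀ X → .{{NonZero X}} → Acc _<_ X → CoprimePart c X
  go X (acc rec) with gcd X c ≟ 1
  ... | yes e≡1 = record
    { part = X ; part∣ = ∣-refl ; part-coprime = gcd≡1⇒coprime e≡1 ; lift-coprime = λ x⊥X _ → x⊥X }
  ... | no e≢1 = record
    { part = part
    ; part∣ = ∣-trans part∣ (m/n∣m e∣X)
    ; part-coprime = part-coprime
    ; lift-coprime = λ x⊥part x⊥e →
        subst (Coprime _) (m/n*n≡m e∣X)
              (coprime-* (lift-coprime x⊥part (coprime-∣ʳ x⊥e gcd[X/e,c]∣e)) x⊥e)
    }
    where
    e : ℕ
    e = gcd X c
    e∣X : e ∣ X
    e∣X = gcd[m,n]∣m X c
    instance
      e-nonZero : NonZero e
      e-nonZero = ∣⇒nonZero e∣X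
      X/e-nonZero : NonZero (X / e)
      X/e-nonZero = >-nonZero (m≥n⇒m/n>0 (∣⇒≤ e∣X))
    gcd[X/e,c]∣e : gcd (X / e) c ∣ e
    gcd[X/e,c]∣e = gcd-greatest (∣-trans (gcd[m,n]∣m (X / e) c) (m/n∣m e∣X)) (gcd[m,n]∣n (X / e) c)
    open CoprimePart (go (X / e) (rec (m/n<m X e (≢1⇒1< e≢1))))

part*q∣ : (P : CoprimePart c X) → q ∣ X → q ∣ c → CoprimePart.part P * q ∣ X
part*q∣ {X = X} {q = q} P q∣X q∣c with CoprimePart.part∣ P
... | divides u X≡u*part = subst (part * q ∣_) (sym X≡part*u) (*-monoʳ-∣ part q∣u)
  where
  open CoprimePart P
  X≡part*u : X ≡ part * u
  X≡part*u = trans X≡u*part (*-comm u part)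
  q∣u : q ∣ u
  q∣u = coprime-divisor (coprime-sym (coprime-∣ʳ part-coprime q∣c)) (subst (q ∣_) X≡part*u q∣X)

modular-inverse : .{{NonTrivial M}} → Coprime x M → ∃[ b ] ∃[ f ] b * x ≡ 1 + f * M
modular-inverse {M} {x} x⊥M with coprime-Bézout x⊥M
... | Bézout.+- b f 1+fM≡bx = b , f , sym 1+fM≡bx
... | Bézout.-+ y zero 1+yx≡0 = contradiction 1+yx≡0 λ ()
-- From 1 + y x = (1 + f) M, multiplying by M − 1 gives y (M − 1) x ≡ 1 (mod M).
... | Bézout.-+ y (suc f) 1+yx≡[1+f]M with M
...   | suc (suc k) = y * (1 + k) , (1 + k) * f + k , +-cancelˡ-≡ (1 + k) _ _ (begin
  1 + k + y * (1 + k) * x                    ≡⟨ expand k y x ⟩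
  (1 + y * x) * (1 + k)                     ≡⟨ cong (_* (1 + k)) 1+yx≡[1+f]M ⟩
  (1 + f) * (2 + k) * (1 + k)               ≡⟨ regroup k f ⟩
  1 + k + (1 + ((1 + k) * f + k) * (2 + k)) ∎)
  where
  open ≡-Reasoning
  expand : ∀ k y x → 1 + k + y * (1 + k) * x ≡ (1 + y * x) * (1 + k)
  expand = solve-∀
  regroup : ∀ k f → (1 + f) * (2 + k) * (1 + k) ≡ 1 + k + (1 + ((1 + k) * f + k) * (2 + k))
  regroup = solve-∀

coprime-shift : ∀ r → .{{NonZero M}} → Coprime m M → ∃[ j ] j < M × Coprime (r + m * j) M
coprime-shift {1} r _ = 0 , s≤s z≤n , coprime-sym (1-coprimeTo _)
coprime-shift {M@(suc (suc k))} {m} r m⊥M with b , f , bm≡1+fM ← modular-inverse m⊥M =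
  j₀ % M , m%n<n j₀ M ,
  coprime-+-*⁻¹ {k = m * (j₀ / M)} ∣-refl
    (subst (λ z → Coprime z M) residue (coprime-+-* {k = r + f * W} ∣-refl (1-coprimeTo M)))
  where
  open ≡-Reasoning
  -- W ≡ 1 − r (mod M), so r + m b W ≡ 1.
  W j₀ : ℕ
  W = (1 + k) * r + 1
  j₀ = b * W
  residue : 1 + (r + f * W) * M ≡ r + m * (j₀ % M) + m * (j₀ / M) * M
  residue = begin
    1 + (r + f * W) * M                  ≡⟨ reduce r f k ⟩
    r + (1 + f * M) * W                  ≡⟨ cong (λ z → r + z * W) (sym bm≡1+fM) ⟩
    r + b * m * W                        ≡⟨ cong (λ z → r + z) (*-comm-middle b m W) ⟩
    r + m * j₀                           ≡⟨ cong (λ z → r + m * z) (m≡m%n+[m/n]*n j₀ M) ⟩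
    r + m * (j₀ % M + j₀ / M * M)        ≡⟨ distribute r m (j₀ % M) (j₀ / M) M ⟩
    r + m * (j₀ % M) + m * (j₀ / M) * M  ∎
    where
    reduce : ∀ r f k → 1 + (r + f * ((1 + k) * r + 1)) * (2 + k) ≡ r + (1 + f * (2 + k)) * ((1 + k) * r + 1)
    reduce = solve-∀
    *-comm-middle : ∀ b m W → b * m * W ≡ m * (b * W)
    *-comm-middle = solve-∀
    distribute : ∀ r m x y M → r + m * (x + y * M) ≡ r + m * x + m * y * M
    distribute = solve-∀

coprime-shift-prime : ∀ r → .{{NonZero X}} → Prime q → q ∣ X → Coprime m X →
                      ∃[ j ] Coprime (r + m * j) X × q * suc j ≤ 2 * X
coprime-shift-prime {X} {q} {m} r q-prime q∣X m⊥X =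
  conclude (avoid-q (coprime-shift r (coprime-∣ʳ m⊥X part∣)))
  where
  P : CoprimePart q X
  P = coprimePart q X
  open CoprimePart P renaming (part to Y)
  instance
    Y-nonZero : NonZero Y
    Y-nonZero = ∣⇒nonZero part∣
  rearrange : ∀ q Y → q * (2 * Y) ≡ 2 * (Y * q)
  rearrange = solve-∀
  -- If q divides r + m j, it does not divide r + m (j + Y), since q divides neither m nor Y.
  avoid-q : ∃[ j ] j < Y × Coprime (r + m * j) Y →
            ∃[ j ] suc j ≤ 2 * Y × Coprime (r + m * j) Y × ¬ q ∣ r + m * j
  avoid-q (j , j<Y , x⊥Y) with q ∣? r + m * j
  ... | no q∤x = j , ≤-trans j<Y (m≤m+n Y (Y + 0)) , x⊥Y , q∤x
  ... | yes q∣x = j + Y , +-mono-≤ j<Y (m≤m+n Y 0) ,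
    subst (λ z → Coprime z Y) (sym shifted) (coprime-+-* {k = m} ∣-refl x⊥Y) ,
    λ q∣x′ → q∤mY (∣m+n∣m⇒∣n (subst (q ∣_) shifted q∣x′) q∣x)
    where
    shifted : r + m * (j + Y) ≡ r + m * j + m * Y
    shifted = trans (cong (λ z → r + z) (*-distribˡ-+ m j Y)) (sym (+-assoc r (m * j) (m * Y)))
    q∤mY : ¬ q ∣ m * Y
    q∤mY q∣mY with euclidsLemma m Y q-prime q∣mY
    ... | inj₁ q∣m = prime∣coprime⇒∤ q-prime m⊥X q∣m q∣X
    ... | inj₂ q∣Y = prime∣coprime⇒∤ q-prime part-coprime q∣Y ∣-refl
  conclude : ∃[ j ] suc j ≤ 2 * Y × Coprime (r + m * j) Y × ¬ q ∣ r + m * j →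
             ∃[ j ] Coprime (r + m * j) X × q * suc j ≤ 2 * X
  conclude (j , 1+j≤2Y , x⊥Y , q∤x) =
    j , lift-coprime x⊥Y (coprime-∣ʳ (∤⇒coprime q-prime q∤x) (gcd[m,n]∣n X q)) , (begin
      q * suc j      ≤⟨ *-monoʳ-≤ q 1+j≤2Y ⟩
      q * (2 * Y)    ≡⟨ rearrange q Y ⟩
      2 * (Y * q)    ≤⟨ *-monoʳ-≤ 2 (∣⇒≤ (part*q∣ P q∣X ∣-refl)) ⟩
      2 * X          ∎)
    where open ≤-Reasoning

coprime-shift-∣6 : ∀ {g} r → d ∣ 6 → d ∣ g → 5 ≤ g → (6 ∣ g → 12 ≤ g) → Coprime m d →
                   ∃[ j ] Coprime (r + m * j) d × 5 * suc j ≤ 2 * g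
coprime-shift-∣6 {d} {m} {g} r d∣6 d∣g 5≤g 6∣g⇒12≤g m⊥d = by-cases (divisor-of-6 d∣6)
  where
  shrink : ∀ {k} → .{{NonZero q}} → ∃[ j ] Coprime (r + m * j) d × q * suc j ≤ q * k →
           5 * k ≤ 2 * g → ∃[ j ] Coprime (r + m * j) d × 5 * suc j ≤ 2 * g
  shrink {q} (j , x⊥d , q[1+j]≤qk) 5k≤2g =
    j , x⊥d , ≤-trans (*-monoʳ-≤ 5 (*-cancelˡ-≤ q q[1+j]≤qk)) 5k≤2g
  prime[3] : Prime 3
  prime[3] = from-yes (prime? 3)
  by-cases : d ≡ 1 ⊎ d ≡ 2 ⊎ d ≡ 3 ⊎ d ≡ 6 → ∃[ j ] Coprime (r + m * j) d × 5 * suc j ≤ 2 * g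
  by-cases (inj₁ refl) = 0 , coprime-sym (1-coprimeTo _) , ≤-trans (m≤m+n 5 5) (*-monoʳ-≤ 2 5≤g)
  by-cases (inj₂ (inj₁ refl)) =
    shrink {q = 2} {k = 2} (coprime-shift-prime r prime[2] ∣-refl m⊥d) (*-monoʳ-≤ 2 5≤g)
  by-cases (inj₂ (inj₂ (inj₁ refl))) =
    shrink {q = 3} {k = 2} (coprime-shift-prime r prime[3] ∣-refl m⊥d) (*-monoʳ-≤ 2 5≤g)
  by-cases (inj₂ (inj₂ (inj₂ refl))) =
    shrink {q = 3} {k = 4} (coprime-shift-prime r prime[3] (divides 2 refl) m⊥d)
           (≤-trans (m≤m+n 20 4) (*-monoʳ-≤ 2 (6∣g⇒12≤g d∣g)))

coprime-shift-bounded : ∀ {g} r → X ∣ g → 5 ≤ g → (6 ∣ g → 12 ≤ g) → Coprime m X →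
                        ∃[ j ] Coprime (r + m * j) X × 5 * suc j ≤ 2 * g
coprime-shift-bounded {X} {m} {g} r X∣g 5≤g 6∣g⇒12≤g m⊥X = by-cases (part ≟ 1)
  where
  open ≤-Reasoning
  instance
    g-nonZero : NonZero g
    g-nonZero = >-nonZero (≤-trans (s≤s z≤n) 5≤g)
    X-nonZero : NonZero X
    X-nonZero = ∣⇒nonZero X∣g
  open CoprimePart (coprimePart 6 X)
  instance
    part-nonZero : NonZero part
    part-nonZero = ∣⇒nonZero part∣
  by-cases : Dec (part ≡ 1) → ∃[ j ] Coprime (r + m * j) X × 5 * suc j ≤ 2 * g
  by-cases (yes part≡1)
    with j , x⊥G , bound ← coprime-shift-∣6 r (gcd[m,n]∣n X 6) (∣-trans (gcd[m,n]∣m X 6) X∣g) 5≤g 6∣g⇒12≤g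
                             (coprime-∣ʳ m⊥X (gcd[m,n]∣m X 6))
    = j , lift-coprime (subst (Coprime _) (sym part≡1) (coprime-sym (1-coprimeTo _))) x⊥G , bound
  by-cases (no part≢1)
    with q , q-prime , q∣part ← prime-factor {{n>1⇒nonTrivial (≢1⇒1< part≢1)}}
    with j , x⊥X , q[1+j]≤2X ← coprime-shift-prime r q-prime (∣-trans q∣part part∣) m⊥X
    = j , x⊥X , (begin
      5 * suc j  ≤⟨ *-monoˡ-≤ (suc j) (prime⊥6⇒5≤p q-prime (coprime-∣ˡ part-coprime q∣part)) ⟩
      q * suc j  ≤⟨ q[1+j]≤2X ⟩
      2 * X      ≤⟨ *-monoʳ-≤ 2 (∣⇒≤ X∣g) ⟩
      2 * g      ∎)

residue-bound : ∀ {g r j} → r < m → 11 ≤ m → 5 * suc j ≤ 2 * g → 2 * (r + m * j + g) ≤ m * g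
residue-bound {m} {g} {r} {j} r<m 11≤m 5[1+j]≤2g = *-cancelˡ-≤ 5 (begin
  5 * (2 * (r + m * j + g))        ≤⟨ *-monoʳ-≤ 5 (*-monoʳ-≤ 2 (+-monoˡ-≤ g (+-monoˡ-≤ (m * j) (<⇒≤ r<m)))) ⟩
  5 * (2 * (m + m * j + g))        ≡⟨ expand m j g ⟩
  2 * m * (5 * suc j) + 10 * g     ≤⟨ +-monoˡ-≤ (10 * g) (*-monoʳ-≤ (2 * m) 5[1+j]≤2g) ⟩
  2 * m * (2 * g) + 10 * g         ≤⟨ +-monoʳ-≤ (2 * m * (2 * g)) (*-monoˡ-≤ g (≤-trans (n≤1+n 10) 11≤m)) ⟩
  2 * m * (2 * g) + m * g          ≡⟨ collect m g ⟩
  5 * (m * g)                      ∎)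
  where
  open ≤-Reasoning
  expand : ∀ m j g → 5 * (2 * (m + m * j + g)) ≡ 2 * m * (5 * (1 + j)) + 10 * g
  expand = solve-∀
  collect : ∀ m g → 2 * m * (2 * g) + m * g ≡ 5 * (m * g)
  collect = solve-∀

multiplier-on-t : ∀ {g t′ f} → b * t′ ≡ 1 + f * m → ∀ k →
               (b + k * m) * (t′ * g) ≡ g + (f + k * t′) * (m * g)
multiplier-on-t {b} {m} {g} {t′} {f} bt′≡1+fm k = begin
  (b + k * m) * (t′ * g)              ≡⟨ expand b k m t′ g ⟩
  b * t′ * g + k * t′ * (m * g)       ≡⟨ cong (λ z → z * g + k * t′ * (m * g)) bt′≡1+fm ⟩
  (1 + f * m) * g + k * t′ * (m * g)  ≡⟨ collect f m g k t′ ⟩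
  g + (f + k * t′) * (m * g)          ∎
  where
  open ≡-Reasoning
  expand : ∀ b k m t′ g → (b + k * m) * (t′ * g) ≡ b * t′ * g + k * t′ * (m * g)
  expand = solve-∀
  collect : ∀ f m g k t′ → (1 + f * m) * g + k * t′ * (m * g) ≡ g + (f + k * t′) * (m * g)
  collect = solve-∀

-- With W = j − Q (mod g) and ŝ s ≡ 1 (mod g), the multiplier b + ŝ W m moves b s = r + Q m to r + m j.
multiplier-on-s : ∀ {g r Q ŝ f g′} → g ≡ suc g′ → b * s ≡ r + Q * m → ŝ * s ≡ 1 + f * g → ∀ j →
               (b + ŝ * (j + g′ * Q) * m) * s ≡ r + m * j + (Q + f * (j + g′ * Q)) * (m * g)
multiplier-on-s {b} {s} {m} {g} {r} {Q} {ŝ} {f} {g′} refl bs≡r+Qm ŝs≡1+fg j = begin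
  (b + ŝ * W * m) * s                 ≡⟨ expand b ŝ W m s ⟩
  b * s + ŝ * s * (W * m)             ≡⟨ cong₂ (λ x y → x + y * (W * m)) bs≡r+Qm ŝs≡1+fg ⟩
  r + Q * m + (1 + f * suc g′) * (W * m) ≡⟨ collect r Q m f g′ j ⟩
  r + m * j + (Q + f * W) * (m * suc g′) ∎
  where
  open ≡-Reasoning
  W : ℕ
  W = j + g′ * Q
  expand : ∀ b ŝ W m s → (b + ŝ * W * m) * s ≡ b * s + ŝ * s * (W * m)
  expand = solve-∀
  collect : ∀ r Q m f g′ j → r + Q * m + (1 + f * suc g′) * ((j + g′ * Q) * m)
                            ≡ r + m * j + (Q + f * (j + g′ * Q)) * (m * suc g′)
  collect = solve-∀

module SmallResidues {n m g s t t′ : ℕ} .{{_ : NonZero n}}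
  (n≡mg : n ≡ m * g) (t≡t′g : t ≡ t′ * g) (t′⊥m : Coprime t′ m) (s⊥g : Coprime s g)
  (11≤m : 11 ≤ m) (5≤g : 5 ≤ g) (6∣g⇒12≤g : 6 ∣ g → 12 ≤ g) where

  instance
    m-nonTrivial : NonTrivial m
    m-nonTrivial = n>1⇒nonTrivial (≤-trans (m≤m+n 2 9) 11≤m)
    g-nonTrivial : NonTrivial g
    g-nonTrivial = n>1⇒nonTrivial (≤-trans (m≤m+n 2 3) 5≤g)
    m-nonZero : NonZero m
    m-nonZero = nonTrivial⇒nonZero m
    g-nonZero : NonZero g
    g-nonZero = nonTrivial⇒nonZero g

  open CoprimePart (coprimePart m g)

  g≡1+[g∸1] : g ≡ suc (g ∸ 1)
  g≡1+[g∸1] = sym (m+[n∸m]≡n (≤-trans (s≤s z≤n) 5≤g))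

  part∣n : part ∣ n
  part∣n = ∣-trans part∣ (subst (g ∣_) (sym n≡mg) (n∣m*n m))

  unit : ∃[ a ] Coprime a n × 2 * ((a * s) % n + (a * t) % n) ≤ n
  unit
    with b , f₁ , bt′≡1+f₁m ← modular-inverse t′⊥m
    with ŝ , f₂ , ŝs≡1+f₂g ← modular-inverse s⊥g
    with j , v⊥part , 5[1+j]≤2g
           ← coprime-shift-bounded (b * s % m) part∣ 5≤g 6∣g⇒12≤g (coprime-sym part-coprime)
    = a , a⊥n , subst (λ z → 2 * z ≤ n) (sym (cong₂ _+_ as%n≡v at%n≡g)) 2[v+g]≤n
    where
    r Q v W k a : ℕ
    r = b * s % m
    Q = b * s / m
    v = r + m * j
    W = j + (g ∸ 1) * Q
    k = ŝ * W
    a = b + k * m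

    as≡v+[Q+f₂W]n : a * s ≡ v + (Q + f₂ * W) * n
    as≡v+[Q+f₂W]n =
      trans (multiplier-on-s {b} {s} {m} {g} {r} {Q} {ŝ} {f₂} g≡1+[g∸1] (m≡m%n+[m/n]*n (b * s) m) ŝs≡1+f₂g j)
            (cong (λ z → v + (Q + f₂ * W) * z) (sym n≡mg))

    at≡g+[f₁+kt′]n : a * t ≡ g + (f₁ + k * t′) * n
    at≡g+[f₁+kt′]n = begin
      a * t                          ≡⟨ cong (a *_) t≡t′g ⟩
      a * (t′ * g)                   ≡⟨ multiplier-on-t {b} {m} {g} {t′} {f₁} bt′≡1+f₁m k ⟩
      g + (f₁ + k * t′) * (m * g)    ≡⟨ cong (λ z → g + (f₁ + k * t′) * z) (sym n≡mg) ⟩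
      g + (f₁ + k * t′) * n          ∎
      where open ≡-Reasoning

    2[v+g]≤n : 2 * (v + g) ≤ n
    2[v+g]≤n = subst (2 * (v + g) ≤_) (sym n≡mg) (residue-bound (m%n<n (b * s) m) 11≤m 5[1+j]≤2g)

    v+g<n : v + g < n
    v+g<n = <-≤-trans (m<m+n (v + g) 0<v+g+0) 2[v+g]≤n
      where
      0<v+g+0 : 0 < v + g + 0
      0<v+g+0 = ≤-trans (>-nonZero⁻¹ g) (≤-trans (m≤n+m g v) (m≤m+n (v + g) 0))

    as%n≡v : (a * s) % n ≡ v
    as%n≡v = m≡r+kn⇒m%n≡r {k = Q + f₂ * W} as≡v+[Q+f₂W]n (≤-<-trans (m≤m+n v g) v+g<n)

    at%n≡g : (a * t) % n ≡ g
    at%n≡g = m≡r+kn⇒m%n≡r {k = f₁ + k * t′} at≡g+[f₁+kt′]n (≤-<-trans (m≤n+m g v) v+g<n)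

    a⊥m : Coprime a m
    a⊥m = coprime-+-* {k = k} ∣-refl b⊥m
      where
      b⊥m : Coprime b m
      b⊥m = coprime-∣ˡ (subst (λ z → Coprime z m) (sym bt′≡1+f₁m)
                               (coprime-+-* {k = f₁} ∣-refl (1-coprimeTo m)))
                       (m∣m*n t′)

    a⊥part : Coprime a part
    a⊥part = coprime-∣ˡ (subst (λ z → Coprime z part) (sym as≡v+[Q+f₂W]n)
                                 (coprime-+-* {k = Q + f₂ * W} part∣n v⊥part))
                        (m∣m*n s)

    a⊥n : Coprime a n
    a⊥n = subst (Coprime a) (sym n≡mg)
                (coprime-* a⊥m (lift-coprime a⊥part (coprime-∣ʳ a⊥m (gcd[m,n]∣n g m))))

6∣∧6<⇒12≤ : ∀ {g} → 6 ∣ g → 6 < g → 12 ≤ g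
6∣∧6<⇒12≤ (divides 0 refl) ()
6∣∧6<⇒12≤ (divides 1 refl) 6<6 = contradiction 6<6 (<-irrefl refl)
6∣∧6<⇒12≤ (divides (suc (suc q)) refl) _ = m≤m+n 12 (q * 6)

factor-bounds : ∀ {g} → n ≡ m * g → 78 < n → (6 < g × 10 * g < n) ⊎ g ≡ 5 →
                5 ≤ g × 11 ≤ m × (6 ∣ g → 12 ≤ g)
factor-bounds {n} {m} {g} n≡mg _ (inj₁ (6<g , 10g<n)) =
  ≤-trans (m≤m+n 5 2) 6<g , *-cancelʳ-< g 10 m (subst (10 * g <_) n≡mg 10g<n) , λ 6∣g → 6∣∧6<⇒12≤ 6∣g 6<g
factor-bounds {n} {m} n≡mg 78<n (inj₂ refl) =
  ≤-refl , *-cancelʳ-< 5 10 m (<-trans (m≤m+n 51 27) (subst (78 <_) n≡mg 78<n)) ,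
  λ 6∣5 → contradiction 6∣5 (from-no (6 ∣? 5))

unit-with-small-residues : .{{_ : NonZero n}} → gcd (gcd n s) t ≡ 1 → 78 < n →
                           (6 < gcd n t × 10 * gcd n t < n) ⊎ gcd n t ≡ 5 →
                           ∃[ a ] Coprime a n × 2 * ((a * s) % n + (a * t) % n) ≤ n
unit-with-small-residues {n} {s} {t} gcd≡1 78<n cases =
  let 5≤g , 11≤m , 6∣g⇒12≤g = factor-bounds n≡mg 78<n cases
  in SmallResidues.unit n≡mg t≡t′g (coprime-sym (coprime-/gcd n t)) s⊥g 11≤m 5≤g 6∣g⇒12≤g
  where
  g : ℕ
  g = gcd n t
  instance
    g-nonZero : NonZero g
    g-nonZero = ≢-nonZero (gcd[m,n]≢0 n t (inj₁ (≢-nonZero⁻¹ n)))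
  n≡mg : n ≡ n / g * g
  n≡mg = sym (m/n*n≡m (gcd[m,n]∣m n t))
  t≡t′g : t ≡ t / g * g
  t≡t′g = sym (m/n*n≡m (gcd[m,n]∣n n t))
  s⊥g : Coprime s g
  s⊥g (e∣s , e∣g) = ∣1⇒≡1 (subst (_ ∣_) gcd≡1
    (gcd-greatest (gcd-greatest (∣-trans e∣g (gcd[m,n]∣m n t)) e∣s) (∣-trans e∣g (gcd[m,n]∣n n t))))

lemma4 : (n s t : ℕ) → {{_ : NonZero n}} →
         1 ≤ s → s ≤ n → 1 ≤ t → t ≤ n →
         gcd (gcd n s) t ≡ 1 →
         ((a : ℤ) → gcdℤ a (+ n) ≡ + 1 →
           (n < 2 * ((a Data.Integer.* + s) %ℕ n + (a Data.Integer.* + t) %ℕ n))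
           × (2 * ((a Data.Integer.* + s) %ℕ n + (a Data.Integer.* + t) %ℕ n) < 3 * n)) →
         ((6 < gcd n t × 10 * gcd n t < n) ⊎ gcd n t ≡ 5) →
         n ≤ 78 ⊎ s + t ≡ n ⊎ s + 2 * t ≡ n ⊎ 2 * s + t ≡ n ⊎ 2 * ∣ s - t ∣ ≡ n
lemma4 n s t _ _ _ _ gcd≡1 hyp cases with n ≤? 78
... | yes n≤78 = inj₁ n≤78
... | no n≰78 = ⊥-elim (no-unit-with-small-residues (unit-with-small-residues gcd≡1 (≰⇒> n≰78) cases))
  where
  no-unit-with-small-residues : ∄[ a ] Coprime a n × 2 * ((a * s) % n + (a * t) % n) ≤ n
  no-unit-with-small-residues (a , a⊥n , small) =
    contradiction (subst (λ z → n < 2 * z) (cong₂ _+_ (residue s) (residue t)) large) (≤⇒≯ small)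
    where
    large : n < 2 * ((+ a Data.Integer.* + s) %ℕ n + (+ a Data.Integer.* + t) %ℕ n)
    large = proj₁ (hyp (+ a) (cong +_ (coprime⇒gcd≡1 a⊥n)))
    residue : ∀ x → (+ a Data.Integer.* + x) %ℕ n ≡ (a * x) % n
    residue x = cong (_%ℕ n) (sym (pos-* a x))
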